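{- Let $x\neq y$ be two vertices of a simple graph $\Gamma$ on a finite set $X$ ($|X|\ge 3$) with matrix $\mathcal{E}$, and let ${}^x\mathcal{E},{}^y\mathcal{E}$ be the matrices of the localized graphs ${}^x\Gamma,{}^y\Gamma$. 1.a. There exist $\nu_k\in\{ -1,1\}$ ($k\in X$) such that $({}^x\mathcal{E})_{k,l}=\nu_k\nu_l({}^y\mathcal{E})_{k,l}$ for all $k,l\in X$, where $\nu_k=-1 \iff k\in{}^y\Gamma(x,1)\iff k\in{}^x\Gamma(y,1)$. 1.b. ${}^y\Gamma(x,1)={}^x\Gamma(y,1)$, and the subgraphs induced by ${}^x\Gamma$ and by ${}^y\Gamma$ on this set are equal. 2. For every pair $\{k,l\}$ of points of $X$, $k$ and $l$ are adjacent in ${}^x\Gamma$ if and only if they are adjacent in ${}^y\Gamma$ exactly when the cardinality of $\{k,l\}\cap{}^y\Gamma(x,1)$ is even.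
   Context: The matrix of a simple graph on $X$ is $\mathcal{E}=(\varepsilon_{i,j})$ with $\varepsilon_{i,j}=-1$ if $i\neq j$ are adjacent and $1$ otherwise. Graphs with matrices $\mathcal{E}=(\varepsilon_{i,j})$, $\mathcal{E}'=(\varepsilon'_{i,j})$ are associated if there exist $\nu_i\in\{ -1,1\}$ with $\varepsilon'_{i,j}=\nu_i\nu_j\varepsilon_{i,j}$ for all $i,j$. For $j\in X$, the localized graph ${}^j\Gamma$ is the unique graph associated to $\Gamma$ in which $j$ is isolated; its matrix ${}^j\mathcal{E}$ is the unique matrix associated to $\mathcal{E}$ whose $j$-th column consists of $1$'s. For a graph $\Lambda$, a vertex $z$ and an integer $d\ge 0$, $\Lambda(z,d)$ is the set of vertices at distance $d$ from $z$ in $\Lambda$. -}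

module Defs where

open import Data.Nat using (ℕ; zero; suc; _<_)
open import Data.Fin using (Fin)
open import Data.Bool using (Bool; true; false; if_then_else_)
open import Data.Integer using (ℤ; +_; -[1+_]; _*_)
open import Data.Sum using (_⊎_)
open import Data.Product using (_×_)
open import Relation.Binary.PropositionalEquality using (_≡_; _≢_)
open import Relation.Nullary using (¬_)

record Graph (n : ℕ) : Set where
  field
    adj    : Fin n → Fin n → Bool
    sym    : ∀ i j → adj i j ≡ adj j i
    irrefl : ∀ i → adj i i ≡ false
open Graph public

Adj : ∀ {n} → Graph n → Fin n → Fin n → Set
Adj Γ i j = adj Γ i j ≡ true

mat : ∀ {n} → Graph n → Fin n → Fin n → ℤ
mat Γ i j = if adj Γ i j then -[1+ 0 ] else + 1

IsSign : ℤ → Set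
IsSign e = (e ≡ + 1) ⊎ (e ≡ -[1+ 0 ])

Associated : ∀ {n} → Graph n → Graph n → Set
Associated {n} Γ Γ' =
  Σν λ ν → (∀ i → IsSign (ν i)) × (∀ i j → mat Γ' i j ≡ (ν i * ν j) * mat Γ i j)
  where
  open import Data.Product using (Σ)
  Σν : ((Fin n → ℤ) → Set) → Set
  Σν P = Σ (Fin n → ℤ) P

Isolated : ∀ {n} → Graph n → Fin n → Set
Isolated Γ j = ∀ k → adj Γ j k ≡ false

-- Λ is "the" localized graph ^jΓ: associated to Γ with j isolated
-- (such a graph exists and is unique).
IsLocalization : ∀ {n} → Graph n → Fin n → Graph n → Set
IsLocalization Γ j Λ = Associated Γ Λ × Isolated Λ j

data Walk {n} (Λ : Graph n) : Fin n → Fin n → ℕ → Set where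
  here : ∀ {a} → Walk Λ a a zero
  step : ∀ {a b c d} → Adj Λ a b → Walk Λ b c d → Walk Λ a c (suc d)

InSphere : ∀ {n} → Graph n → Fin n → ℕ → Fin n → Set
InSphere Λ z d k = Walk Λ z k d × (∀ m → m < d → ¬ Walk Λ z k m)

data PairCount {n} (S : Fin n → Set) (k l : Fin n) : ℕ → Set where
  both    : S k → S l → PairCount S k l 2
  onlyK   : S k → ¬ S l → PairCount S k l 1
  onlyL   : ¬ S k → S l → PairCount S k l 1
  neither : ¬ S k → ¬ S l → PairCount S k l 0

-- Encoding the signs ±1 by booleans turns products of signs into xor, so a graph
-- associated to Γ is a Seidel switching of Γ: its adjacency is
-- (β i xor β j) xor adj Γ i j for some β.  Two switchings of Γ are switchings of
-- each other, and once the switching from ^yΓ to ^xΓ isolates x, the switching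
-- function may be taken to be the neighbourhood of x in ^yΓ.  All claims are read
-- off this description of ^xΓ in terms of ^yΓ.
module Submission where

open import Defs hiding (sym)
open import Data.Nat using (ℕ; _≤_; zero; suc; s≤s)
open import Data.Nat.Properties using (n<1+n)
open import Data.Nat.Divisibility using (_∣_; _∤_; _∣0; ∣-refl; >⇒∤)
open import Data.Fin using (Fin)
open import Data.Integer using (ℤ; +_; -[1+_]; _*_)
open import Data.Bool using (Bool; true; false; _xor_; if_then_else_)
open import Data.Bool.Properties using (xor-assoc; xor-same; xor-identityʳ; ¬-not; xor-∧-commutativeRing)
open import Data.Product using (Σ; _×_; _,_; proj₁; proj₂)
open import Data.Sum using (inj₁; inj₂)
open import Data.Empty using (⊥-elim)
open import Function using (_∘_; case_of_)
open import Relation.Nullary using (¬_)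
open import Function.Bundles using (_⇔_; mk⇔; Equivalence)
open import Function.Properties.Equivalence using () renaming (refl to ⇔-refl; sym to ⇔-sym; trans to ⇔-trans)
open import Relation.Binary.PropositionalEquality using (_≡_; _≢_; refl; sym; trans; cong; cong₂; subst; module ≡-Reasoning)
open import Algebra.Bundles using (CommutativeRing)
open import Algebra.Properties.CommutativeSemigroup
  (CommutativeRing.+-commutativeSemigroup xor-∧-commutativeRing) using (interchange)

open Equivalence using (to; from)
open ≡-Reasoning

private
  variable
    n : ℕ

sign : Bool → ℤ
sign b = if b then -[1+ 0 ] else + 1

sign-xor : ∀ a b → sign (a xor b) ≡ sign a * sign b
sign-xor false false = refl
sign-xor false true  = refl
sign-xor true  false = refl
sign-xor true  true  = refl

sign-injective : ∀ {a b} → sign a ≡ sign b → a ≡ b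
sign-injective {false} {false} _ = refl
sign-injective {true}  {true}  _ = refl

sign≡-1⇔≡true : ∀ b → sign b ≡ -[1+ 0 ] ⇔ b ≡ true
sign≡-1⇔≡true false = mk⇔ (λ ()) (λ ())
sign≡-1⇔≡true true  = mk⇔ (λ _ → refl) (λ _ → refl)

isSign⇒sign : ∀ {e} → IsSign e → Σ Bool λ b → e ≡ sign b
isSign⇒sign (inj₁ e≡1)  = false , e≡1
isSign⇒sign (inj₂ e≡-1) = true , e≡-1

sign-isSign : ∀ b → IsSign (sign b)
sign-isSign false = inj₁ refl
sign-isSign true  = inj₂ refl

xor-cancelˡ : ∀ a b → a xor (a xor b) ≡ b
xor-cancelˡ a b = trans (sym (xor-assoc a a b)) (cong (_xor b) (xor-same a))

xor≡false⇔≡ : ∀ {a b} → a xor b ≡ false ⇔ a ≡ b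
xor≡false⇔≡ {a} = mk⇔ xor≡false⇒≡ (λ { refl → xor-same a })
  where
  xor≡false⇒≡ : ∀ {a b} → a xor b ≡ false → a ≡ b
  xor≡false⇒≡ {false} b≡false = sym b≡false
  xor≡false⇒≡ {true} {true} _ = refl

xor-preserves-true⇔≡false : ∀ s c → (s xor c ≡ true ⇔ c ≡ true) ⇔ s ≡ false
xor-preserves-true⇔≡false false c     = mk⇔ (λ _ → refl) (λ _ → ⇔-refl)
xor-preserves-true⇔≡false true  false = mk⇔ (λ e → case to e refl of λ ()) (λ ())
xor-preserves-true⇔≡false true  true  = mk⇔ (λ e → case from e refl of λ ()) (λ ())

record SwitchedBy (Γ : Graph n) (β : Fin n → Bool) (Λ : Graph n) : Set where
  field
    adj-switched : ∀ i j → adj Λ i j ≡ (β i xor β j) xor adj Γ i j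
open SwitchedBy

associated⇒switched : {Γ Λ : Graph n} → Associated Γ Λ → Σ (Fin n → Bool) λ β → SwitchedBy Γ β Λ
associated⇒switched {n = n} {Γ = Γ} {Λ} (ν , ν-isSign , mat≡) =
  β , record { adj-switched = λ i j → sign-injective (sign-adj≡ i j) }
  where
  β : Fin n → Bool
  β i = proj₁ (isSign⇒sign (ν-isSign i))
  ν≡sign : ∀ i → ν i ≡ sign (β i)
  ν≡sign i = proj₂ (isSign⇒sign (ν-isSign i))
  sign-adj≡ : ∀ i j → sign (adj Λ i j) ≡ sign ((β i xor β j) xor adj Γ i j)
  sign-adj≡ i j = begin
    mat Λ i j                                    ≡⟨ mat≡ i j ⟩
    (ν i * ν j) * mat Γ i j                      ≡⟨ cong₂ (λ a b → (a * b) * mat Γ i j) (ν≡sign i) (ν≡sign j) ⟩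
    (sign (β i) * sign (β j)) * sign (adj Γ i j) ≡⟨ cong (_* mat Γ i j) (sym (sign-xor (β i) (β j))) ⟩
    sign (β i xor β j) * sign (adj Γ i j)        ≡⟨ sym (sign-xor (β i xor β j) (adj Γ i j)) ⟩
    sign ((β i xor β j) xor adj Γ i j)           ∎

switched-mat : {Γ Λ : Graph n} {β : Fin n → Bool} → SwitchedBy Γ β Λ →
               ∀ i j → mat Λ i j ≡ (sign (β i) * sign (β j)) * mat Γ i j
switched-mat {Γ = Γ} {Λ} {β} switched i j = begin
  mat Λ i j                                    ≡⟨ cong sign (adj-switched switched i j) ⟩
  sign ((β i xor β j) xor adj Γ i j)           ≡⟨ sign-xor (β i xor β j) (adj Γ i j) ⟩
  sign (β i xor β j) * mat Γ i j               ≡⟨ cong (_* mat Γ i j) (sign-xor (β i) (β j)) ⟩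
  (sign (β i) * sign (β j)) * mat Γ i j        ∎

switched-sym : {Γ Λ : Graph n} {β : Fin n → Bool} → SwitchedBy Γ β Λ → SwitchedBy Λ β Γ
switched-sym {Γ = Γ} {Λ} {β} switched .adj-switched i j = begin
  adj Γ i j                                      ≡⟨ sym (xor-cancelˡ (β i xor β j) (adj Γ i j)) ⟩
  (β i xor β j) xor ((β i xor β j) xor adj Γ i j) ≡⟨ cong ((β i xor β j) xor_) (sym (adj-switched switched i j)) ⟩
  (β i xor β j) xor adj Λ i j                    ∎

switched-trans : {Γ Λ Δ : Graph n} {β γ : Fin n → Bool} →
                 SwitchedBy Γ β Λ → SwitchedBy Λ γ Δ → SwitchedBy Γ (λ i → γ i xor β i) Δ
switched-trans {Γ = Γ} {Λ} {Δ} {β} {γ} Γ→Λ Λ→Δ .adj-switched i j = begin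
  adj Δ i j                                           ≡⟨ adj-switched Λ→Δ i j ⟩
  (γ i xor γ j) xor adj Λ i j                         ≡⟨ cong ((γ i xor γ j) xor_) (adj-switched Γ→Λ i j) ⟩
  (γ i xor γ j) xor ((β i xor β j) xor adj Γ i j)     ≡⟨ sym (xor-assoc (γ i xor γ j) (β i xor β j) (adj Γ i j)) ⟩
  ((γ i xor γ j) xor (β i xor β j)) xor adj Γ i j     ≡⟨ cong (_xor adj Γ i j) (interchange (γ i) (γ j) (β i) (β j)) ⟩
  ((γ i xor β i) xor (γ j xor β j)) xor adj Γ i j     ∎

-- If a switching isolates x, the switching function differs from the neighbourhood
-- of x by the constant γ x, which cancels in γ i xor γ j.
switched-isolating : {Γ Λ : Graph n} {γ : Fin n → Bool} {x : Fin n} →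
                     SwitchedBy Γ γ Λ → Isolated Λ x → SwitchedBy Γ (adj Γ x) Λ
switched-isolating {Γ = Γ} {Λ} {γ} {x} switched x-isolated .adj-switched i j = begin
  adj Λ i j                                      ≡⟨ adj-switched switched i j ⟩
  (γ i xor γ j) xor adj Γ i j                    ≡⟨ cong (_xor adj Γ i j) γ-difference ⟩
  (adj Γ x i xor adj Γ x j) xor adj Γ i j        ∎
  where
  γx-xor-γ≡adj : ∀ l → γ x xor γ l ≡ adj Γ x l
  γx-xor-γ≡adj l = to xor≡false⇔≡ (trans (sym (adj-switched switched x l)) (x-isolated l))
  γ-difference : γ i xor γ j ≡ adj Γ x i xor adj Γ x j
  γ-difference = begin
    γ i xor γ j                            ≡⟨ cong (_xor (γ i xor γ j)) (sym (xor-same (γ x))) ⟩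
    (γ x xor γ x) xor (γ i xor γ j)        ≡⟨ interchange (γ x) (γ x) (γ i) (γ j) ⟩
    (γ x xor γ i) xor (γ x xor γ j)        ≡⟨ cong₂ _xor_ (γx-xor-γ≡adj i) (γx-xor-γ≡adj j) ⟩
    adj Γ x i xor adj Γ x j                ∎

localizations-switched : {Γ Γx Γy : Graph n} {x y : Fin n} →
                         IsLocalization Γ x Γx → IsLocalization Γ y Γy → SwitchedBy Γy (adj Γy x) Γx
localizations-switched {Γ = Γ} (Γ~Γx , x-isolated) (Γ~Γy , _)
  with associated⇒switched {Γ = Γ} Γ~Γx | associated⇒switched {Γ = Γ} Γ~Γy
... | _ , Γ→Γx | _ , Γ→Γy = switched-isolating (switched-trans (switched-sym Γ→Γy) Γ→Γx) x-isolated

neighbourhood-swap : {Γ Λ : Graph n} {x y : Fin n} →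
                     SwitchedBy Γ (adj Γ x) Λ → Isolated Γ y → ∀ k → adj Λ y k ≡ adj Γ x k
neighbourhood-swap {Γ = Γ} {Λ} {x} {y} switched y-isolated k = begin
  adj Λ y k                                  ≡⟨ adj-switched switched y k ⟩
  (adj Γ x y xor adj Γ x k) xor adj Γ y k    ≡⟨ cong₂ (λ a b → (a xor adj Γ x k) xor b)
                                                      (trans (Graph.sym Γ x y) (y-isolated x)) (y-isolated k) ⟩
  adj Γ x k xor false                        ≡⟨ xor-identityʳ (adj Γ x k) ⟩
  adj Γ x k                                  ∎

switched-Adj⇔ : {Γ Λ : Graph n} {β : Fin n → Bool} → SwitchedBy Γ β Λ →
                ∀ i j → (Adj Λ i j ⇔ Adj Γ i j) ⇔ β i ≡ β j
switched-Adj⇔ {Γ = Γ} {β = β} switched i j rewrite adj-switched switched i j =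
  ⇔-trans (xor-preserves-true⇔≡false (β i xor β j) (adj Γ i j)) xor≡false⇔≡

sphere₁⇔Adj : (Λ : Graph n) (z k : Fin n) → InSphere Λ z 1 k ⇔ Adj Λ z k
sphere₁⇔Adj Λ z k = mk⇔ (λ { (step z~k here , _) → z~k }) λ z~k → step z~k here , λ
  { zero    _         here → case trans (sym (irrefl Λ z)) z~k of λ ()
  ; (suc m) (s≤s ()) _ }

2∤1 : 2 ∤ 1
2∤1 = >⇒∤ (n<1+n 1)

pairCount-parity : {S : Fin n → Set} (p : Fin n → Bool) → (∀ k → S k ⇔ p k ≡ true) →
                   ∀ {k l c} → PairCount S k l c → p k ≡ p l ⇔ 2 ∣ c
pairCount-parity p S⇔p (both Sk Sl) =
  mk⇔ (λ _ → ∣-refl) (λ _ → trans (to (S⇔p _) Sk) (sym (to (S⇔p _) Sl)))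
pairCount-parity p S⇔p (onlyK Sk ¬Sl) =
  mk⇔ (λ pk≡pl → ⊥-elim (¬Sl (from (S⇔p _) (trans (sym pk≡pl) (to (S⇔p _) Sk))))) (⊥-elim ∘ 2∤1)
pairCount-parity p S⇔p (onlyL ¬Sk Sl) =
  mk⇔ (λ pk≡pl → ⊥-elim (¬Sk (from (S⇔p _) (trans pk≡pl (to (S⇔p _) Sl))))) (⊥-elim ∘ 2∤1)
pairCount-parity p S⇔p (neither ¬Sk ¬Sl) =
  mk⇔ (λ _ → 2 ∣0) (λ _ → trans (¬-not (¬Sk ∘ from (S⇔p _))) (sym (¬-not (¬Sl ∘ from (S⇔p _)))))

mainTheorem4 :
    ∀ (n : ℕ) → 3 ≤ n →
    (Γ Γx Γy : Graph n) (x y : Fin n) → x ≢ y →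
    IsLocalization Γ x Γx → IsLocalization Γ y Γy →
    (Σ (Fin n → ℤ) λ ν →
        (∀ k → IsSign (ν k))
      × (∀ k l → mat Γx k l ≡ (ν k * ν l) * mat Γy k l)
      × (∀ k → (ν k ≡ -[1+ 0 ] ⇔ InSphere Γy x 1 k)
             × (InSphere Γy x 1 k ⇔ InSphere Γx y 1 k)))
    × (∀ k → InSphere Γy x 1 k ⇔ InSphere Γx y 1 k)
    × (∀ k l → InSphere Γy x 1 k → InSphere Γy x 1 l →
         Adj Γx k l ⇔ Adj Γy k l)
    × (∀ k l → k ≢ l →
         ∀ c → PairCount (InSphere Γy x 1) k l c →
         ((Adj Γx k l ⇔ Adj Γy k l) ⇔ (2 ∣ c)))
mainTheorem4 n _ Γ Γx Γy x y _ locX locY@(_ , y-isolated) =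
  ( (λ k → sign (adj Γy x k)) , (λ k → sign-isSign (adj Γy x k))
  , switched-mat switched , λ k → ν≡-1⇔sphere k , spheres k )
  , spheres , adjacent-on-sphere , parity
  where
  switched : SwitchedBy Γy (adj Γy x) Γx
  switched = localizations-switched {Γ = Γ} {y = y} locX locY
  ν≡-1⇔sphere : ∀ k → sign (adj Γy x k) ≡ -[1+ 0 ] ⇔ InSphere Γy x 1 k
  ν≡-1⇔sphere k = ⇔-trans (sign≡-1⇔≡true (adj Γy x k)) (⇔-sym (sphere₁⇔Adj Γy x k))
  spheres : ∀ k → InSphere Γy x 1 k ⇔ InSphere Γx y 1 k
  spheres k = ⇔-trans (subst (λ b → InSphere Γy x 1 k ⇔ b ≡ true) (sym (neighbourhood-swap switched y-isolated k))
                              (sphere₁⇔Adj Γy x k))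
                       (⇔-sym (sphere₁⇔Adj Γx y k))
  adjacent-on-sphere : ∀ k l → InSphere Γy x 1 k → InSphere Γy x 1 l → Adj Γx k l ⇔ Adj Γy k l
  adjacent-on-sphere k l x~k x~l =
    from (switched-Adj⇔ switched k l) (trans (to (sphere₁⇔Adj Γy x k) x~k) (sym (to (sphere₁⇔Adj Γy x l) x~l)))
  parity : ∀ k l → k ≢ l → ∀ c → PairCount (InSphere Γy x 1) k l c → (Adj Γx k l ⇔ Adj Γy k l) ⇔ 2 ∣ c
  parity k l _ c count =
    ⇔-trans (switched-Adj⇔ switched k l) (pairCount-parity (adj Γy x) (sphere₁⇔Adj Γy x) count)
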